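{- Let $n\ge 1$ and $k\ge1$ be integers. The number of compositions of the graph $P_n^2$ with exactly $k$ components is $\binom{n+k-2}{n-k}$, and the total number of compositions of $P_n^2$ is $F_{2n-1}$, where $F_1=F_2=1$, $F_{j+1}=F_j+F_{j-1}$ are the Fibonacci numbers.
   Context: $P_n^2$ is the graph with vertex set $\{1,\dots,n\}$ in which $i$ and $j$ are adjacent iff $1\le |i-j|\le 2$ (the square of the path $P_n$). A composition of a graph $G$ with $k$ components is a partition of its vertex set into $k$ blocks, each inducing a connected subgraph of $G$. -}

module Defs where

open import Data.Nat using (ℕ; zero; suc; _+_; _∸_; _≤_; _<_; _≤?_; ∣_-_∣)
open import Data.Nat.Combinatorics using (_C_)
open import Data.Fin using (Fin; toℕ)
open import Data.Vec using (Vec; lookup)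
open import Data.List using (List; length)
open import Data.List.Membership.Propositional using (_∈_)
open import Data.List.Relation.Unary.Unique.Propositional using (Unique)
open import Data.Product using (Σ; ∃; _×_; _,_)
open import Relation.Binary.PropositionalEquality using (_≡_)
open import Relation.Nullary using (yes; no)
open import Function.Bundles using (_⇔_)

-- The square of the path P_n on vertex set Fin n (vertex i ~ the paper's i+1):
-- i and j adjacent iff 1 ≤ |i - j| ≤ 2.
Adj : {n : ℕ} → Fin n → Fin n → Set
Adj i j = (1 ≤ ∣ toℕ i - toℕ j ∣) × (∣ toℕ i - toℕ j ∣ ≤ 2)

-- A partition of the vertex set into k blocks is encoded by a block
-- labelling  f : Vec (Fin k) n  (vertex i lies in block  lookup f i).
data Walk {n k : ℕ} (f : Vec (Fin k) n) (b : Fin k) : Fin n → Fin n → Set where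
  here : ∀ {u} → lookup f u ≡ b → Walk f b u u
  step : ∀ {u w v} → lookup f u ≡ b → Adj u w → Walk f b w v → Walk f b u v

Surjective : {n k : ℕ} → Vec (Fin k) n → Set
Surjective {n} {k} f = (b : Fin k) → ∃ λ (i : Fin n) → lookup f i ≡ b

-- Canonical labelling (restricted growth): blocks are numbered in order of
-- their least element, so each set partition has exactly one labelling.
Canonical : {n k : ℕ} → Vec (Fin k) n → Set
Canonical {n} {k} f = (i : Fin n) (b : Fin k) → toℕ b < toℕ (lookup f i) →
  ∃ λ (i' : Fin n) → (toℕ i' < toℕ i) × (lookup f i' ≡ b)

BlocksConnected : {n k : ℕ} → Vec (Fin k) n → Set
BlocksConnected {n} {k} f = (u v : Fin n) → lookup f u ≡ lookup f v →
  Walk f (lookup f u) u v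

IsComposition : (n k : ℕ) → Vec (Fin k) n → Set
IsComposition n k f = Surjective f × Canonical f × BlocksConnected f

HasCount : {A : Set} → (A → Set) → ℕ → Set
HasCount {A} P m = Σ (List A) λ xs → Unique xs × ((x : A) → (x ∈ xs ⇔ P x)) × (length xs ≡ m)

binomNK : ℕ → ℕ → ℕ
binomNK n k with k ≤? n
... | yes _ = (n + k ∸ 2) C (n ∸ k)
... | no _  = 0

fib : ℕ → ℕ
fib zero = zero
fib (suc zero) = suc zero
fib (suc (suc j)) = fib (suc j) + fib j

-- A labelling is a composition of P²ₙ iff it is surjective, canonical, and any two
-- consecutive vertices of a block are at distance at most two; in the square of a path this
-- is exactly connectivity of the blocks.  Hence a composition of n + 2 vertices arises
-- uniquely from a composition of n + 1 vertices by putting the new vertex into the block of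
-- the last vertex, into the block of the penultimate vertex (possible only when the last two
-- vertices lie in different blocks), or into a new block.  If c(n, k) counts the compositions
-- of n + 1 vertices with k blocks and s(n, k) those whose last two vertices lie in different
-- blocks, this gives
--   c(n + 1, k) = c(n, k) + s(n + 1, k)   and   s(n + 1, k) = s(n, k) + c(n, k - 1),
-- which Pascal's rule solves by c(n, a + 1) = C(n + a, 2a) and s(n, a + 2) = C(n + a, 2a + 1).
-- Summing over k, the same recursion produces consecutive Fibonacci numbers.

module Submission where

open import Defs
open import Data.Nat using (ℕ; zero; suc; _+_; _*_; _∸_; _≤_; _<_; z≤n; s≤s)
open import Data.Nat.Properties
open import Data.Nat.Combinatorics using (_C_; k>n⇒nCk≡0; nCk+nC[k+1]≡[n+1]C[k+1]; nCk≡nC[n∸k])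
open import Data.Fin as Fin using (Fin; zero; suc; toℕ; inject₁; fromℕ)
open import Data.Fin.Properties using (any?; toℕ-fromℕ; toℕ-inject₁; toℕ-injective; toℕ<n; inject₁ℕ<; inject₁-injective; fromℕ≢inject₁)
open import Data.Vec as Vec using (Vec; []; _∷_; lookup; _∷ʳ_; last; init; initLast)
open import Data.Vec.Properties using (init-∷ʳ; last-∷ʳ; lookup-map; ∷-injective; ∷ʳ-injective; ∷ʳ-injectiveˡ)
open import Data.Product as Product using (Σ; ∃; _×_; _,_; proj₁; proj₂)
open import Data.Sum using (inj₁; inj₂)
open import Data.List as List using (List; []; _∷_; _++_; length)
open import Data.List.Properties using (length-++; length-map)
open import Data.List.Membership.Propositional using (_∈_)
open import Data.List.Membership.Propositional.Properties using (∈-map⁺; ∈-map⁻; ∈-++⁺ˡ; ∈-++⁺ʳ)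
open import Data.List.Relation.Unary.Any using (here; there)
open import Data.List.Relation.Unary.All as All using (All; []; _∷_)
import Data.List.Relation.Unary.All.Properties as All
import Data.List.Relation.Unary.AllPairs as AllPairs
open import Data.List.Relation.Unary.Unique.Propositional using (Unique)
import Data.List.Relation.Unary.Unique.Propositional.Properties as Unique
open import Data.Product.Properties using (,-injectiveʳ-UIP)
open import Data.Empty using (⊥; ⊥-elim)
open import Relation.Binary.PropositionalEquality
open import Relation.Nullary using (Dec; yes; no; ¬_; ¬?)
open import Relation.Nullary.Decidable using (decidable-stable)
open import Function.Base using (_∋_; _∘_; id)
open import Function.Bundles using (_⇔_; mk⇔; module Equivalence)
open import Function.Definitions using (Injective)
open import Relation.Binary.Definitions using (tri<; tri≈; tri>)

private variable
  A : Set
  n k : ℕ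

data LastView : {n : ℕ} → Fin (suc n) → Set where
  old : (i : Fin n) → LastView (inject₁ i)
  new : LastView (fromℕ n)

lastView : (i : Fin (suc n)) → LastView i
lastView {zero}  zero    = new
lastView {suc n} zero    = old zero
lastView {suc n} (suc i) with lastView i
... | old j = old (suc j)
... | new   = new

inject₁<fromℕ : (i : Fin n) → toℕ (inject₁ i) < toℕ (fromℕ n)
inject₁<fromℕ {n} i = subst (toℕ (inject₁ i) <_) (sym (toℕ-fromℕ n)) (inject₁ℕ< i)

inject₁-preserves : (R : ℕ → ℕ → Set) {i j : Fin n} → R (toℕ i) (toℕ j) → R (toℕ (inject₁ i)) (toℕ (inject₁ j))
inject₁-preserves R {i} {j} = subst₂ R (sym (toℕ-inject₁ i)) (sym (toℕ-inject₁ j))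

inject₁-reflects : (R : ℕ → ℕ → Set) {i j : Fin n} → R (toℕ (inject₁ i)) (toℕ (inject₁ j)) → R (toℕ i) (toℕ j)
inject₁-reflects R {i} {j} = subst₂ R (toℕ-inject₁ i) (toℕ-inject₁ j)

fromℕ≮ : (j : Fin (suc n)) → ¬ (toℕ (fromℕ n) < toℕ j)
fromℕ≮ {n} j lt = <⇒≱ lt (subst (toℕ j ≤_) (sym (toℕ-fromℕ n)) (≤-pred (toℕ<n j)))

lookup-∷ʳ-inject₁ : (xs : Vec A n) (x : A) (i : Fin n) → lookup (xs ∷ʳ x) (inject₁ i) ≡ lookup xs i
lookup-∷ʳ-inject₁ (y ∷ xs) x zero    = refl
lookup-∷ʳ-inject₁ (y ∷ xs) x (suc i) = lookup-∷ʳ-inject₁ xs x i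

lookup-∷ʳ-fromℕ : (xs : Vec A n) (x : A) → lookup (xs ∷ʳ x) (fromℕ n) ≡ x
lookup-∷ʳ-fromℕ []       x = refl
lookup-∷ʳ-fromℕ (y ∷ xs) x = lookup-∷ʳ-fromℕ xs x

lookup-fromℕ : (xs : Vec A (suc n)) → lookup xs (fromℕ n) ≡ last xs
lookup-fromℕ xs with initLast xs
... | ys , y , refl = lookup-∷ʳ-fromℕ ys y

lookup-inject₁-fromℕ : (xs : Vec A (suc (suc n))) → lookup xs (inject₁ (fromℕ n)) ≡ last (init xs)
lookup-inject₁-fromℕ xs with initLast xs
... | ys , y , refl = trans (lookup-∷ʳ-inject₁ ys y (fromℕ _)) (lookup-fromℕ ys)

∷ʳ-elim : (P : Vec A (suc n) → Set) → (∀ g y → P (g ∷ʳ y)) → ∀ v → P v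
∷ʳ-elim P p v with initLast v
... | g , y , refl = p g y

map-injective : ∀ {B : Set} {h : A → B} → Injective _≡_ _≡_ h → Injective _≡_ _≡_ (Vec.map {n = n} h)
map-injective h-inj {[]}     {[]}     _  = refl
map-injective h-inj {x ∷ xs} {y ∷ ys} eq =
  let hx≡hy , eq′ = ∷-injective eq in cong₂ _∷_ (h-inj hx≡hy) (map-injective h-inj eq′)

Σ-map-injective : {P Q : ℕ → Set} {σ : ℕ → ℕ} {t : ∀ {k} → P k → Q (σ k)} → Injective _≡_ _≡_ σ →
                  (∀ {k} → Injective _≡_ _≡_ (t {k})) → Injective _≡_ _≡_ (Product.map {P = P} {Q = Q} σ t)
Σ-map-injective σ-inj t-inj {k , x} {_ , _} eq with σ-inj (cong proj₁ eq)
... | refl = cong (k ,_) (t-inj (,-injectiveʳ-UIP ≡-irrelevant eq))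

adj⇒≤2+ : {u w : Fin n} → Adj u w → toℕ w ≤ 2 + toℕ u
adj⇒≤2+ {u = u} {w} (_ , d≤2) = begin
  toℕ w                   ≤⟨ m≤n+m∸n (toℕ w) (toℕ u) ⟩
  toℕ u + (toℕ w ∸ toℕ u) ≤⟨ +-monoʳ-≤ (toℕ u) (≤-trans (m∸n≤∣m-n∣ (toℕ w) (toℕ u)) (subst (_≤ 2) (∣-∣-comm (toℕ u) (toℕ w)) d≤2)) ⟩
  toℕ u + 2               ≡⟨ +-comm (toℕ u) 2 ⟩
  2 + toℕ u               ∎
  where open ≤-Reasoning

adj-from-< : {u w : Fin n} → toℕ u < toℕ w → toℕ w ≤ 2 + toℕ u → Adj u w
adj-from-< {u = u} {w} u<w w≤2+u = subst (λ d → 1 ≤ d × d ≤ 2) (sym (m≤n⇒∣m-n∣≡n∸m (<⇒≤ u<w)))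
  (m<n⇒0<n∸m u<w , m≤n+o⇒m∸n≤o (toℕ w) (toℕ u) (subst (toℕ w ≤_) (+-comm 2 (toℕ u)) w≤2+u))

adj-sym : {u w : Fin n} → Adj u w → Adj w u
adj-sym {u = u} {w} = subst (λ d → 1 ≤ d × d ≤ 2) (∣-∣-comm (toℕ u) (toℕ w))

adj-irrefl : (u : Fin n) → ¬ Adj u u
adj-irrefl u (1≤d , _) = <-irrefl (sym (∣n-n∣≡0 (toℕ u))) 1≤d

module _ {f : Vec (Fin k) n} where

  walk-head : ∀ {b u v} → Walk f b u v → lookup f u ≡ b
  walk-head (here fu≡b)     = fu≡b
  walk-head (step fu≡b _ _) = fu≡b

  walk-snoc : ∀ {b u v w} → Walk f b u v → Adj v w → lookup f w ≡ b → Walk f b u w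
  walk-snoc (here fv≡b)        v~w fw≡b = step fv≡b v~w (here fw≡b)
  walk-snoc (step fu≡b u~w′ p) v~w fw≡b = step fu≡b u~w′ (walk-snoc p v~w fw≡b)

  walk-reverse : ∀ {b u v} → Walk f b u v → Walk f b v u
  walk-reverse (here fu≡b)                 = here fu≡b
  walk-reverse (step {u} {w} fu≡b u~w p) = walk-snoc (walk-reverse p) (adj-sym {u = u} {w} u~w) fu≡b

  walk-leaves : ∀ {b u v} → Walk f b u v → u ≢ v → ∃ λ w → Adj u w × lookup f w ≡ b
  walk-leaves (here _)       u≢v = ⊥-elim (u≢v refl)
  walk-leaves (step _ u~w p) _   = _ , u~w , walk-head p

  -- Edges have length at most two, so a walk from the left of t + 1 to the right of it
  -- must visit t + 1 or t + 2.
  walk-crosses : ∀ {b u v} → Walk f b u v → (t : ℕ) → toℕ u ≤ t → t < toℕ v →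
                 ∃ λ m → t < toℕ m × toℕ m ≤ 2 + t × lookup f m ≡ b
  walk-crosses (here _) t u≤t t<u = ⊥-elim (<⇒≱ t<u u≤t)
  walk-crosses (step {w = w} fu≡b u~w p) t u≤t t<v with toℕ w ≤? t
  ... | yes w≤t = walk-crosses p t w≤t t<v
  ... | no  w≰t = w , ≰⇒> w≰t , ≤-trans (adj⇒≤2+ u~w) (+-monoʳ-≤ 2 u≤t) , walk-head p

ShortStep : Vec (Fin k) n → Fin n → Fin n → Set
ShortStep f i m = toℕ i < toℕ m × toℕ m ≤ 2 + toℕ i × lookup f m ≡ lookup f i

ShortGaps : Vec (Fin k) n → Set
ShortGaps {n = n} f = (i j : Fin n) → toℕ i < toℕ j → lookup f i ≡ lookup f j → ∃ (ShortStep f i)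

module _ {f : Vec (Fin k) n} where

  blocksConnected⇒shortGaps : BlocksConnected f → ShortGaps f
  blocksConnected⇒shortGaps conn i j i<j fi≡fj = walk-crosses (conn i j fi≡fj) (toℕ i) ≤-refl i<j

  -- d is fuel bounding the remaining distance.
  walk-forward : ShortGaps f → (d : ℕ) {b : Fin k} (u v : Fin n) → toℕ v ∸ toℕ u ≤ d → toℕ u ≤ toℕ v →
                 lookup f u ≡ b → lookup f v ≡ b → Walk f b u v
  walk-forward gaps d u v v∸u≤d u≤v fu≡b fv≡b with toℕ u ≟ toℕ v
  ... | yes u≡v = subst (Walk f _ u) (toℕ-injective u≡v) (here fu≡b)
  ... | no  u≢v with gaps u v (≤∧≢⇒< u≤v u≢v) (trans fu≡b (sym fv≡b))
  ...   | m , u<m , m≤2+u , fm≡fu with toℕ m ≤? toℕ v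
  ...     | no m≰v = step fu≡b (adj-from-< (≤∧≢⇒< u≤v u≢v) (≤-trans (<⇒≤ (≰⇒> m≰v)) m≤2+u)) (here fv≡b)
  walk-forward gaps zero u v v∸u≤0 u≤v _ _ | no u≢v | _ | yes _ =
    ⊥-elim (<⇒≱ (m<n⇒0<n∸m (≤∧≢⇒< u≤v u≢v)) v∸u≤0)
  walk-forward gaps (suc d) u v v∸u≤d u≤v fu≡b fv≡b | no u≢v | m , u<m , m≤2+u , fm≡fu | yes m≤v =
    step fu≡b (adj-from-< u<m m≤2+u)
      (walk-forward gaps d m v (≤-pred (≤-trans (∸-monoʳ-< u<m m≤v) v∸u≤d)) m≤v (trans fm≡fu fu≡b) fv≡b)

  shortGaps⇒blocksConnected : ShortGaps f → BlocksConnected f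
  shortGaps⇒blocksConnected gaps u v fu≡fv with ≤-total (toℕ u) (toℕ v)
  ... | inj₁ u≤v = walk-forward gaps _ u v ≤-refl u≤v refl (sym fu≡fv)
  ... | inj₂ v≤u = walk-reverse (walk-forward gaps _ v u ≤-refl v≤u (sym fu≡fv) refl)

Composition : Vec (Fin k) n → Set
Composition f = Surjective f × Canonical f × ShortGaps f

isComposition⇔composition : {f : Vec (Fin k) n} → IsComposition n k f ⇔ Composition f
isComposition⇔composition = mk⇔ (Product.map₂ (Product.map₂ blocksConnected⇒shortGaps))
                                (Product.map₂ (Product.map₂ shortGaps⇒blocksConnected))

module _ {f : Vec (Fin k) n} {y : Fin k} where

  surjective-∷ʳ : Surjective f → Surjective (f ∷ʳ y)
  surjective-∷ʳ surj b = let i , fi≡b = surj b in inject₁ i , trans (lookup-∷ʳ-inject₁ f y i) fi≡b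

  surjective-init : Surjective (f ∷ʳ y) → (∃ λ i → lookup f i ≡ y) → Surjective f
  surjective-init surj (i₀ , fi₀≡y) b with surj b
  ... | i , fi≡b with lastView i
  ...   | old j = j , trans (sym (lookup-∷ʳ-inject₁ f y j)) fi≡b
  ...   | new   = i₀ , trans fi₀≡y (trans (sym (lookup-∷ʳ-fromℕ f y)) fi≡b)

  canonical-init : Canonical (f ∷ʳ y) → Canonical f
  canonical-init canon i b b<fi
    with canon (inject₁ i) b (subst (λ c → toℕ b < toℕ c) (sym (lookup-∷ʳ-inject₁ f y i)) b<fi)
  ... | i′ , i′<i , fi′≡b with lastView i′
  ...   | old j = j , inject₁-reflects _<_ i′<i , trans (sym (lookup-∷ʳ-inject₁ f y j)) fi′≡b
  ...   | new   = ⊥-elim (fromℕ≮ (inject₁ i) i′<i)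

  canonical-∷ʳ : Canonical f → (∀ b → toℕ b < toℕ y → ∃ λ i → lookup f i ≡ b) → Canonical (f ∷ʳ y)
  canonical-∷ʳ canon used i b b<fi with lastView i
  ... | old j =
    let j′ , j′<j , fj′≡b = canon j b (subst (λ c → toℕ b < toℕ c) (lookup-∷ʳ-inject₁ f y j) b<fi)
    in inject₁ j′ , inject₁-preserves _<_ j′<j , trans (lookup-∷ʳ-inject₁ f y j′) fj′≡b
  ... | new =
    let j , fj≡b = used b (subst (λ c → toℕ b < toℕ c) (lookup-∷ʳ-fromℕ f y) b<fi)
    in inject₁ j , inject₁<fromℕ j , trans (lookup-∷ʳ-inject₁ f y j) fj≡b

  shortStep-∷ʳ : ∀ {i m} → ShortStep f i m → ShortStep (f ∷ʳ y) (inject₁ i) (inject₁ m)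
  shortStep-∷ʳ {i} {m} (i<m , m≤2+i , fm≡fi) =
    inject₁-preserves _<_ i<m , inject₁-preserves (λ a c → a ≤ 2 + c) m≤2+i ,
    trans (lookup-∷ʳ-inject₁ f y m) (trans fm≡fi (sym (lookup-∷ʳ-inject₁ f y i)))

  shortGaps-init : ShortGaps (f ∷ʳ y) → ShortGaps f
  shortGaps-init gaps i j i<j fi≡fj
    with gaps (inject₁ i) (inject₁ j) (inject₁-preserves _<_ i<j)
              (trans (lookup-∷ʳ-inject₁ f y i) (trans fi≡fj (sym (lookup-∷ʳ-inject₁ f y j))))
  ... | m , i<m , m≤2+i , fm≡fi with lastView m
  ...   | old m′ = m′ , inject₁-reflects _<_ i<m , inject₁-reflects (λ a c → a ≤ 2 + c) m≤2+i ,
                   trans (sym (lookup-∷ʳ-inject₁ f y m′)) (trans fm≡fi (lookup-∷ʳ-inject₁ f y i))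
  -- A step from i to the removed last vertex already bounds j, which lies before it.
  ...   | new    = j , i<j ,
                   ≤-trans (<⇒≤ (toℕ<n j)) (subst₂ (λ a c → a ≤ 2 + c) (toℕ-fromℕ n) (toℕ-inject₁ i) m≤2+i) ,
                   sym fi≡fj

  shortGaps-∷ʳ : ShortGaps f → (∀ i → lookup f i ≡ y → ∃ (ShortStep (f ∷ʳ y) (inject₁ i))) → ShortGaps (f ∷ʳ y)
  shortGaps-∷ʳ gaps ends i j i<j fi≡fj with lastView i | lastView j
  ... | new    | _      = ⊥-elim (fromℕ≮ j i<j)
  ... | old i′ | old j′ = Product.map inject₁ shortStep-∷ʳ (gaps i′ j′ (inject₁-reflects _<_ i<j)
                            (trans (sym (lookup-∷ʳ-inject₁ f y i′)) (trans fi≡fj (lookup-∷ʳ-inject₁ f y j′))))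
  ... | old i′ | new    = ends i′ (trans (sym (lookup-∷ʳ-inject₁ f y i′)) (trans fi≡fj (lookup-∷ʳ-fromℕ f y)))

  composition-init : Composition (f ∷ʳ y) → (∃ λ i → lookup f i ≡ y) → Composition f
  composition-init (surj , canon , gaps) y∈f =
    surjective-init surj y∈f , canonical-init canon , shortGaps-init gaps

  -- The new vertex has a neighbour in its block.
  occurs-near-end : Composition (f ∷ʳ y) → ∀ {i} → lookup f i ≡ y → ∃ λ p → lookup f p ≡ y × n ≤ 2 + toℕ p
  occurs-near-end (_ , _ , gaps) {i} fi≡y
    with walk-leaves (shortGaps⇒blocksConnected {f = f ∷ʳ y} gaps (fromℕ n) (inject₁ i)
           (trans (lookup-∷ʳ-fromℕ f y) (sym (trans (lookup-∷ʳ-inject₁ f y i) fi≡y)))) fromℕ≢inject₁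
  ... | w , top~w , fw≡y with lastView w
  ...   | new   = ⊥-elim (adj-irrefl (fromℕ n) top~w)
  ...   | old p = p , trans (sym (lookup-∷ʳ-inject₁ f y p)) (trans fw≡y (lookup-∷ʳ-fromℕ f y)) ,
                  subst₂ (λ a c → a ≤ 2 + c) (toℕ-fromℕ n) (toℕ-inject₁ p) (adj⇒≤2+ (adj-sym {u = fromℕ n} top~w))

composition-copy : {f : Vec (Fin k) n} → Composition f → (p : Fin n) → n ≤ 2 + toℕ p →
                   (∀ q → toℕ p < toℕ q → lookup f q ≢ lookup f p) → Composition (f ∷ʳ lookup f p)
composition-copy {n = n} {f = f} (surj , canon , gaps) p p-near-end p-last =
  surjective-∷ʳ {f = f} {y} surj ,
  canonical-∷ʳ {f = f} {y} canon (λ b b<fp → let i , _ , fi≡b = canon p b b<fp in i , fi≡b) ,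
  shortGaps-∷ʳ {f = f} {y} gaps step-from
  where
  y = lookup f p
  step-from : ∀ i → lookup f i ≡ y → ∃ (ShortStep (f ∷ʳ y) (inject₁ i))
  step-from i fi≡y with <-cmp (toℕ i) (toℕ p)
  ... | tri< i<p _ _ = Product.map inject₁ (shortStep-∷ʳ {f = f} {y}) (gaps i p i<p fi≡y)
  ... | tri> _ _ p<i = ⊥-elim (p-last i p<i fi≡y)
  ... | tri≈ _ i≡p _ =
    fromℕ n , inject₁<fromℕ i ,
    subst₂ (λ a c → a ≤ 2 + c) (sym (toℕ-fromℕ n)) (sym (trans (toℕ-inject₁ i) i≡p)) p-near-end ,
    trans (lookup-∷ʳ-fromℕ f y) (sym (trans (lookup-∷ʳ-inject₁ f y i) fi≡y))

module _ {k′ : ℕ} {h : Fin k → Fin k′} (h-injective : Injective _≡_ _≡_ h) {f : Vec (Fin k) n} where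

  private
    same-block-map⁺ : ∀ {i j} → lookup f i ≡ lookup f j → lookup (Vec.map h f) i ≡ lookup (Vec.map h f) j
    same-block-map⁺ {i} {j} fi≡fj = trans (lookup-map i h f) (trans (cong h fi≡fj) (sym (lookup-map j h f)))

    same-block-map⁻ : ∀ {i j} → lookup (Vec.map h f) i ≡ lookup (Vec.map h f) j → lookup f i ≡ lookup f j
    same-block-map⁻ {i} {j} hfi≡hfj = h-injective (trans (sym (lookup-map i h f)) (trans hfi≡hfj (lookup-map j h f)))

  shortGaps-map⁺ : ShortGaps f → ShortGaps (Vec.map h f)
  shortGaps-map⁺ gaps i j i<j fi≡fj =
    Product.map₂ (Product.map₂ (Product.map₂ same-block-map⁺)) (gaps i j i<j (same-block-map⁻ fi≡fj))

  shortGaps-map⁻ : ShortGaps (Vec.map h f) → ShortGaps f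
  shortGaps-map⁻ gaps i j i<j fi≡fj =
    Product.map₂ (Product.map₂ (Product.map₂ same-block-map⁻)) (gaps i j i<j (same-block-map⁺ fi≡fj))

module _ {f : Vec (Fin k) n} where

  canonical-map-inject₁⁺ : Canonical f → Canonical (Vec.map inject₁ f)
  canonical-map-inject₁⁺ canon i b b<fi with lastView b
  ... | new   = ⊥-elim (fromℕ≮ (inject₁ (lookup f i)) (subst (λ c → _ < toℕ c) (lookup-map i inject₁ f) b<fi))
  ... | old c =
    let i′ , i′<i , fi′≡c = canon i c (inject₁-reflects _<_ (subst (λ d → _ < toℕ d) (lookup-map i inject₁ f) b<fi))
    in i′ , i′<i , trans (lookup-map i′ inject₁ f) (cong inject₁ fi′≡c)

  canonical-map-inject₁⁻ : Canonical (Vec.map inject₁ f) → Canonical f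
  canonical-map-inject₁⁻ canon i b b<fi =
    let i′ , i′<i , fi′≡b = canon i (inject₁ b) (subst (λ d → _ < toℕ d) (sym (lookup-map i inject₁ f))
                                                   (inject₁-preserves _<_ b<fi))
    in i′ , i′<i , inject₁-injective (trans (sym (lookup-map i′ inject₁ f)) fi′≡b)

withNewBlock : Vec (Fin k) n → Vec (Fin (suc k)) (suc n)
withNewBlock {k} f = Vec.map inject₁ f ∷ʳ fromℕ k

module _ {f : Vec (Fin k) n} where

  composition-withNewBlock : Composition f → Composition (withNewBlock f)
  composition-withNewBlock (surj , canon , gaps) =
    surjective ,
    canonical-∷ʳ {f = Vec.map inject₁ f} (canonical-map-inject₁⁺ {f = f} canon) old-used ,
    shortGaps-∷ʳ {f = Vec.map inject₁ f} (shortGaps-map⁺ inject₁-injective {f = f} gaps)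
                 (λ i fi≡top → ⊥-elim (top∉ i fi≡top))
    where
    old-used : ∀ b → toℕ b < toℕ (fromℕ k) → ∃ λ i → lookup (Vec.map inject₁ f) i ≡ b
    old-used b b<top with lastView b
    ... | new   = ⊥-elim (<-irrefl refl b<top)
    ... | old c = let i , fi≡c = surj c in i , trans (lookup-map i inject₁ f) (cong inject₁ fi≡c)
    surjective : Surjective (withNewBlock f)
    surjective b with lastView b
    ... | new   = fromℕ n , lookup-∷ʳ-fromℕ (Vec.map inject₁ f) (fromℕ k)
    ... | old c = let i , fi≡b = old-used (inject₁ c) (inject₁<fromℕ c)
                  in inject₁ i , trans (lookup-∷ʳ-inject₁ (Vec.map inject₁ f) (fromℕ k) i) fi≡b
    top∉ : ∀ i → lookup (Vec.map inject₁ f) i ≢ fromℕ k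
    top∉ i fi≡top = fromℕ≢inject₁ (sym (trans (sym (lookup-map i inject₁ f)) fi≡top))

  composition-withoutNewBlock : Composition (withNewBlock f) → Composition f
  composition-withoutNewBlock (surj , canon , gaps) =
    surjective ,
    canonical-map-inject₁⁻ {f = f} (canonical-init {f = Vec.map inject₁ f} canon) ,
    shortGaps-map⁻ inject₁-injective {f = f} (shortGaps-init {f = Vec.map inject₁ f} gaps)
    where
    surjective : Surjective f
    surjective b with surj (inject₁ b)
    ... | i , fi≡b with lastView i
    ...   | new   = ⊥-elim (fromℕ≢inject₁ (trans (sym (lookup-∷ʳ-fromℕ (Vec.map inject₁ f) (fromℕ k))) fi≡b))
    ...   | old j = j , inject₁-injective (begin
      inject₁ (lookup f j)                          ≡⟨ lookup-map j inject₁ f ⟨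
      lookup (Vec.map inject₁ f) j                  ≡⟨ lookup-∷ʳ-inject₁ (Vec.map inject₁ f) (fromℕ k) j ⟨
      lookup (withNewBlock f) (inject₁ j)           ≡⟨ fi≡b ⟩
      inject₁ b                                     ∎)
      where open ≡-Reasoning

-- The top label occurs in f, and canonicity would make the smaller label y occur before it.
fresh-label-is-top : {f : Vec (Fin (suc k)) n} {y : Fin (suc k)} → Composition (f ∷ʳ y) →
                     (∀ i → lookup f i ≢ y) → y ≡ fromℕ k
fresh-label-is-top {k} {f = f} {y} (surj , canon , _) y∉f with lastView y
... | new   = refl
... | old c with surj (fromℕ k)
...   | i , fi≡top with lastView i
...     | new   = ⊥-elim (fromℕ≢inject₁ (trans (sym fi≡top) (lookup-∷ʳ-fromℕ f (inject₁ c))))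
...     | old j =
  let fj≡top = trans (sym (lookup-∷ʳ-inject₁ f (inject₁ c) j)) fi≡top
      j′ , _ , fj′≡y = canonical-init {f = f} canon j (inject₁ c)
                         (subst (λ d → toℕ (inject₁ c) < toℕ d) (sym fj≡top) (inject₁<fromℕ c))
  in ⊥-elim (y∉f j′ fj′≡y)

avoiding-top⇒map-inject₁ : (f : Vec (Fin (suc k)) n) → (∀ i → lookup f i ≢ fromℕ k) →
                           ∃ λ g → f ≡ Vec.map inject₁ g
avoiding-top⇒map-inject₁ []      _    = [] , refl
avoiding-top⇒map-inject₁ (x ∷ f) top∉ with lastView x | avoiding-top⇒map-inject₁ f (λ i → top∉ (suc i))
... | new   | _          = ⊥-elim (top∉ zero refl)
... | old c | g , f≡map = c ∷ g , cong (inject₁ c ∷_) f≡map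

SplitEnd : Vec A (suc n) → Set
SplitEnd {n = zero}  _ = ⊥
SplitEnd {n = suc n} v = last (init v) ≢ last v

splitEnd? : (v : Vec (Fin k) (suc n)) → Dec (SplitEnd v)
splitEnd? {n = zero}  _ = no (λ ())
splitEnd? {n = suc n} v = ¬? (last (init v) Fin.≟ last v)

module _ (g : Vec A (suc n)) (y : A) where

  splitEnd-∷ʳ⁺ : last g ≢ y → SplitEnd (g ∷ʳ y)
  splitEnd-∷ʳ⁺ g≢y split = g≢y (trans (sym (cong last (init-∷ʳ y g))) (trans split (last-∷ʳ y g)))

  splitEnd-∷ʳ⁻ : SplitEnd (g ∷ʳ y) → last g ≢ y
  splitEnd-∷ʳ⁻ split g≡y = split (trans (cong last (init-∷ʳ y g)) (trans g≡y (sym (last-∷ʳ y g))))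

joinLast : Vec A (suc n) → Vec A (suc (suc n))
joinLast f = f ∷ʳ last f

joinPenultimate : Vec A (suc (suc n)) → Vec A (suc (suc (suc n)))
joinPenultimate f = f ∷ʳ last (init f)

module _ {f : Vec (Fin k) (suc n)} where

  composition-joinLast : Composition f → Composition (joinLast f)
  composition-joinLast comp = subst Composition (cong (f ∷ʳ_) (lookup-fromℕ f))
    (composition-copy {f = f} comp (fromℕ n) (subst (λ d → suc n ≤ 2 + d) (sym (toℕ-fromℕ n)) (n≤1+n (suc n)))
                      (λ q top<q → ⊥-elim (fromℕ≮ q top<q)))

  ¬splitEnd-joinLast : ¬ SplitEnd (joinLast f)
  ¬splitEnd-joinLast split = splitEnd-∷ʳ⁻ f (last f) split refl

  splitEnd-withNewBlock : SplitEnd (withNewBlock f)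
  splitEnd-withNewBlock = splitEnd-∷ʳ⁺ (Vec.map inject₁ f) (fromℕ k) λ last≡top →
    fromℕ≢inject₁ (sym (trans (sym (lookup-map (fromℕ n) inject₁ f))
                              (trans (lookup-fromℕ (Vec.map inject₁ f)) last≡top)))

module _ {f : Vec (Fin k) (suc (suc n))} where

  composition-joinPenultimate : Composition f → SplitEnd f → Composition (joinPenultimate f)
  composition-joinPenultimate comp split = subst Composition (cong (f ∷ʳ_) (lookup-inject₁-fromℕ f))
    (composition-copy {f = f} comp p (subst (λ d → suc (suc n) ≤ 2 + d) (sym toℕp≡n) ≤-refl) p-last)
    where
    p = inject₁ (fromℕ n)
    toℕp≡n : toℕ p ≡ n
    toℕp≡n = trans (toℕ-inject₁ (fromℕ n)) (toℕ-fromℕ n)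
    p-last : ∀ q → toℕ p < toℕ q → lookup f q ≢ lookup f p
    p-last q p<q with lastView q
    ... | new   = λ fq≡fp → split (trans (sym (lookup-inject₁-fromℕ f)) (trans (sym fq≡fp) (lookup-fromℕ f)))
    ... | old r = ⊥-elim (<⇒≱ p<q (subst₂ _≤_ (sym (toℕ-inject₁ r)) (sym toℕp≡n) (≤-pred (toℕ<n r))))

  splitEnd-joinPenultimate : SplitEnd f → SplitEnd (joinPenultimate f)
  splitEnd-joinPenultimate split = splitEnd-∷ʳ⁺ f (last (init f)) (λ last≡pen → split (sym last≡pen))

Labelling : ℕ → Set
Labelling n = Σ ℕ λ k → Vec (Fin k) n

-- The lists indexed by n hold labellings of n + 1 vertices.
mutual
  sameEndCompositions : (n : ℕ) → List (Labelling (suc n))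
  sameEndCompositions zero    = (1 , zero ∷ []) ∷ []
  sameEndCompositions (suc n) = List.map (Product.map₂ joinLast) (compositions n)

  splitEndCompositions : (n : ℕ) → List (Labelling (suc n))
  splitEndCompositions zero          = []
  splitEndCompositions (suc zero)    = newBlockCompositions zero
  splitEndCompositions (suc (suc n)) =
    List.map (Product.map₂ joinPenultimate) (splitEndCompositions (suc n)) ++ newBlockCompositions (suc n)

  newBlockCompositions : (n : ℕ) → List (Labelling (suc (suc n)))
  newBlockCompositions n = List.map (Product.map suc withNewBlock) (compositions n)

  compositions : (n : ℕ) → List (Labelling (suc n))
  compositions n = sameEndCompositions n ++ splitEndCompositions n

newBlock⊆splitEnd : ∀ n {x} → x ∈ newBlockCompositions n → x ∈ splitEndCompositions (suc n)
newBlock⊆splitEnd zero    x∈ = x∈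
newBlock⊆splitEnd (suc n) x∈ = ∈-++⁺ʳ (List.map (Product.map₂ joinPenultimate) (splitEndCompositions (suc n))) x∈

composition-single : Composition {k = 1} (zero ∷ [])
composition-single = (λ { zero → zero , refl }) , (λ { zero zero () }) , (λ { zero zero () })

mutual
  sameEnd-sound : ∀ n → All (λ x → Composition (proj₂ x) × ¬ SplitEnd (proj₂ x)) (sameEndCompositions n)
  sameEnd-sound zero    = (composition-single , λ ()) ∷ []
  sameEnd-sound (suc n) = All.map⁺ (All.map (λ {(_ , g)} comp →
    composition-joinLast {f = g} comp , ¬splitEnd-joinLast {f = g}) (compositions-sound n))

  splitEnd-sound : ∀ n → All (λ x → Composition (proj₂ x) × SplitEnd (proj₂ x)) (splitEndCompositions n)
  splitEnd-sound zero          = []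
  splitEnd-sound (suc zero)    = newBlock-sound zero
  splitEnd-sound (suc (suc n)) = All.++⁺ (All.map⁺ (All.map (λ {(_ , g)} (comp , split) →
    composition-joinPenultimate {f = g} comp split , splitEnd-joinPenultimate {f = g} split)
      (splitEnd-sound (suc n)))) (newBlock-sound (suc n))

  newBlock-sound : ∀ n → All (λ x → Composition (proj₂ x) × SplitEnd (proj₂ x)) (newBlockCompositions n)
  newBlock-sound n = All.map⁺ (All.map (λ {(_ , g)} comp →
    composition-withNewBlock {f = g} comp , splitEnd-withNewBlock {f = g}) (compositions-sound n))

  compositions-sound : ∀ n → All (Composition ∘ proj₂) (compositions n)
  compositions-sound n = All.++⁺ (All.map proj₁ (sameEnd-sound n)) (All.map proj₁ (splitEnd-sound n))

composition-single-unique : (x : Fin k) → Composition (x ∷ []) → (Labelling 1 ∋ (k , x ∷ [])) ≡ (1 , zero ∷ [])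
composition-single-unique {suc zero}    zero    _                = refl
composition-single-unique {suc (suc k)} zero    (surj , _)      with surj (suc zero)
... | zero , ()
composition-single-unique               (suc x) (_ , canon , _) with canon zero zero (s≤s z≤n)
... | _ , () , _

repeated-label-is-penultimate : (g : Vec (Fin k) (suc (suc n))) {y : Fin k} → Composition (g ∷ʳ y) →
                                last g ≢ y → ∀ {i} → lookup g i ≡ y → last (init g) ≡ y
repeated-label-is-penultimate {n = n} g comp last≢y gi≡y with occurs-near-end {f = g} comp gi≡y
... | p , gp≡y , near with lastView p
...   | new    = ⊥-elim (last≢y (trans (sym (lookup-fromℕ g)) gp≡y))
...   | old p′ with lastView p′
...     | new   = trans (sym (lookup-inject₁-fromℕ g)) gp≡y
...     | old r = ⊥-elim (<⇒≱ (toℕ<n r)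
                   (+-cancelˡ-≤ 2 n (toℕ r) (subst (λ d → 2 + n ≤ 2 + d) (trans (toℕ-inject₁ _) (toℕ-inject₁ r)) near)))

mutual
  compositions-complete : ∀ n {k} (f : Vec (Fin k) (suc n)) → Composition f → (k , f) ∈ compositions n
  compositions-complete n f comp with splitEnd? f
  ... | no  same  = ∈-++⁺ˡ (sameEnd-complete n f comp same)
  ... | yes split = ∈-++⁺ʳ (sameEndCompositions n) (splitEnd-complete n f comp split)

  sameEnd-complete : ∀ n {k} (f : Vec (Fin k) (suc n)) → Composition f → ¬ SplitEnd f →
                     (k , f) ∈ sameEndCompositions n
  sameEnd-complete zero    (x ∷ []) comp _ = here (composition-single-unique x comp)
  sameEnd-complete (suc n) = ∷ʳ-elim _ λ g y comp same →
    let last≡y = decidable-stable (last g Fin.≟ y) (λ last≢y → same (splitEnd-∷ʳ⁺ g y last≢y))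
    in subst (λ z → (_ , g ∷ʳ z) ∈ _) last≡y
         (∈-map⁺ (Product.map₂ joinLast)
            (compositions-complete n g (composition-init {f = g} comp (fromℕ n , trans (lookup-fromℕ g) last≡y))))

  splitEnd-complete : ∀ n {k} (f : Vec (Fin k) (suc n)) → Composition f → SplitEnd f →
                      (k , f) ∈ splitEndCompositions n
  splitEnd-complete (suc n) = ∷ʳ-elim _ (splitEnd-complete-∷ʳ n)

  splitEnd-complete-∷ʳ : ∀ n {k} (g : Vec (Fin k) (suc n)) (y : Fin k) → Composition (g ∷ʳ y) →
                         SplitEnd (g ∷ʳ y) → (k , g ∷ʳ y) ∈ splitEndCompositions (suc n)
  splitEnd-complete-∷ʳ n g y comp split with any? (λ i → lookup g i Fin.≟ y)
  ... | no y∉g = newBlock⊆splitEnd n (newBlock-complete n g comp (λ i gi≡y → y∉g (i , gi≡y)))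
  splitEnd-complete-∷ʳ zero (x ∷ []) y comp split | yes (zero , x≡y) = ⊥-elim (splitEnd-∷ʳ⁻ (x ∷ []) y split x≡y)
  splitEnd-complete-∷ʳ (suc n) g y comp split | yes (i , gi≡y) =
    subst (λ z → (_ , g ∷ʳ z) ∈ _) pen≡y
      (∈-++⁺ˡ (∈-map⁺ (Product.map₂ joinPenultimate)
         (splitEnd-complete (suc n) g (composition-init {f = g} comp (i , gi≡y))
            (λ pen≡last → splitEnd-∷ʳ⁻ g y split (trans (sym pen≡last) pen≡y)))))
    where
    pen≡y : last (init g) ≡ y
    pen≡y = repeated-label-is-penultimate g comp (splitEnd-∷ʳ⁻ g y split) gi≡y

  newBlock-complete : ∀ n {k} (g : Vec (Fin k) (suc n)) {y : Fin k} → Composition (g ∷ʳ y) →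
                      (∀ i → lookup g i ≢ y) → (k , g ∷ʳ y) ∈ newBlockCompositions n
  newBlock-complete n {suc k} g {y} comp y∉g with fresh-label-is-top {f = g} comp y∉g
  ... | refl with avoiding-top⇒map-inject₁ g y∉g
  ...   | h , refl = ∈-map⁺ (Product.map suc withNewBlock)
                       (compositions-complete n h (composition-withoutNewBlock {f = h} comp))

joinLast-injective : Injective _≡_ _≡_ (joinLast {A = A} {n = n})
joinLast-injective {x = f} {g} eq = ∷ʳ-injectiveˡ f g eq

joinPenultimate-injective : Injective _≡_ _≡_ (joinPenultimate {A = A} {n = n})
joinPenultimate-injective {x = f} {g} eq = ∷ʳ-injectiveˡ f g eq

withNewBlock-injective : Injective _≡_ _≡_ (withNewBlock {k = k} {n = n})
withNewBlock-injective {x = f} {g} eq = map-injective inject₁-injective (∷ʳ-injectiveˡ (Vec.map inject₁ f) _ eq)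

joinPenultimate≢withNewBlock : (g : Vec (Fin (suc k)) (suc (suc n))) (h : Vec (Fin k) (suc (suc n))) →
                               joinPenultimate g ≢ withNewBlock h
joinPenultimate≢withNewBlock {k} {n} g h eq with ∷ʳ-injective g (Vec.map inject₁ h) eq
... | refl , pen≡top = fromℕ≢inject₁ (begin
  fromℕ k                                        ≡⟨ pen≡top ⟨
  last (init (Vec.map inject₁ h))                ≡⟨ lookup-inject₁-fromℕ (Vec.map inject₁ h) ⟨
  lookup (Vec.map inject₁ h) (inject₁ (fromℕ n)) ≡⟨ lookup-map (inject₁ (fromℕ n)) inject₁ h ⟩
  inject₁ (lookup h (inject₁ (fromℕ n)))         ∎)
  where open ≡-Reasoning

joins-newBlocks-disjoint : (xs : List (Labelling (suc (suc n)))) (ys : List (Labelling (suc (suc n)))) →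
  ∀ {x} → ¬ (x ∈ List.map (Product.map₂ joinPenultimate) xs × x ∈ List.map (Product.map suc withNewBlock) ys)
joins-newBlocks-disjoint xs ys (x∈joins , x∈new) with ∈-map⁻ (Product.map₂ joinPenultimate) x∈joins
... | (_ , g) , _ , refl with ∈-map⁻ (Product.map suc withNewBlock) x∈new
...   | (_ , h) , _ , eq with cong proj₁ eq
...     | refl = joinPenultimate≢withNewBlock g h (,-injectiveʳ-UIP ≡-irrelevant eq)

mutual
  sameEnd-unique : ∀ n → Unique (sameEndCompositions n)
  sameEnd-unique zero    = [] AllPairs.∷ AllPairs.[]
  sameEnd-unique (suc n) = Unique.map⁺ (Σ-map-injective id joinLast-injective) (compositions-unique n)

  splitEnd-unique : ∀ n → Unique (splitEndCompositions n)
  splitEnd-unique zero          = AllPairs.[]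
  splitEnd-unique (suc zero)    = newBlock-unique zero
  splitEnd-unique (suc (suc n)) =
    Unique.++⁺ (Unique.map⁺ (Σ-map-injective id joinPenultimate-injective) (splitEnd-unique (suc n)))
               (newBlock-unique (suc n)) (joins-newBlocks-disjoint _ _)

  newBlock-unique : ∀ n → Unique (newBlockCompositions n)
  newBlock-unique n = Unique.map⁺ (Σ-map-injective suc-injective withNewBlock-injective) (compositions-unique n)

  compositions-unique : ∀ n → Unique (compositions n)
  compositions-unique n = Unique.++⁺ (sameEnd-unique n) (splitEnd-unique n) λ (x∈same , x∈split) →
    proj₂ (All.lookup (sameEnd-sound n) x∈same) (proj₂ (All.lookup (splitEnd-sound n) x∈split))

withBlockCount : (k : ℕ) → List (Labelling n) → List (Vec (Fin k) n)
withBlockCount k []              = []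
withBlockCount k ((k′ , f) ∷ xs) with k′ ≟ k
... | yes refl = f ∷ withBlockCount k xs
... | no  _    = withBlockCount k xs

module _ {k : ℕ} where

  ∈-withBlockCount⁺ : {xs : List (Labelling n)} {f : Vec (Fin k) n} → (k , f) ∈ xs → f ∈ withBlockCount k xs
  ∈-withBlockCount⁺ {xs = (k′ , g) ∷ xs} (here refl) with k ≟ k
  ... | yes refl = here refl
  ... | no  k≢k  = ⊥-elim (k≢k refl)
  ∈-withBlockCount⁺ {xs = (k′ , g) ∷ xs} (there x∈) with k′ ≟ k
  ... | yes refl = there (∈-withBlockCount⁺ x∈)
  ... | no  _    = ∈-withBlockCount⁺ x∈

  ∈-withBlockCount⁻ : {xs : List (Labelling n)} {f : Vec (Fin k) n} → f ∈ withBlockCount k xs → (k , f) ∈ xs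
  ∈-withBlockCount⁻ {xs = (k′ , g) ∷ xs} f∈ with k′ ≟ k
  ∈-withBlockCount⁻ {xs = (k′ , g) ∷ xs} (here refl)  | yes refl = here refl
  ∈-withBlockCount⁻ {xs = (k′ , g) ∷ xs} (there f∈′) | yes refl = there (∈-withBlockCount⁻ f∈′)
  ∈-withBlockCount⁻ {xs = (k′ , g) ∷ xs} f∈           | no  _    = there (∈-withBlockCount⁻ f∈)

  withBlockCount-unique : {xs : List (Labelling n)} → Unique xs → Unique (withBlockCount k xs)
  withBlockCount-unique {xs = []}             _             = AllPairs.[]
  withBlockCount-unique {xs = (k′ , g) ∷ xs} (g∉xs AllPairs.∷ xs!) with k′ ≟ k
  ... | yes refl = All.tabulate (λ f∈ g≡f → All.lookup g∉xs (∈-withBlockCount⁻ f∈) (cong (k ,_) g≡f))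
                   AllPairs.∷ withBlockCount-unique xs!
  ... | no  _    = withBlockCount-unique xs!

count : ℕ → List (Labelling n) → ℕ
count k xs = length (withBlockCount k xs)

module _ {k : ℕ} where

  count-++ : (xs ys : List (Labelling n)) → count k (xs ++ ys) ≡ count k xs + count k ys
  count-++ []              ys = refl
  count-++ ((k′ , f) ∷ xs) ys with k′ ≟ k
  ... | yes refl = cong (1 +_) (count-++ xs ys)
  ... | no  _    = count-++ xs ys

  count-map : ∀ {m} {σ : ℕ → ℕ} → Injective _≡_ _≡_ σ → (t : ∀ {j} → Vec (Fin j) n → Vec (Fin (σ j)) m) →
              (xs : List (Labelling n)) → count (σ k) (List.map (Product.map σ t) xs) ≡ count k xs
  count-map σ-inj t []              = refl
  count-map {σ = σ} σ-inj t ((k′ , f) ∷ xs) with k′ ≟ k | σ k′ ≟ σ k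
  ... | yes refl | yes refl    = cong (1 +_) (count-map σ-inj t xs)
  ... | yes refl | no  σk≢σk   = ⊥-elim (σk≢σk refl)
  ... | no  k′≢k | yes σk′≡σk = ⊥-elim (k′≢k (σ-inj σk′≡σk))
  ... | no  _    | no  _       = count-map σ-inj t xs

count-zero-map-suc : ∀ {m} (t : ∀ {j} → Vec (Fin j) n → Vec (Fin (suc j)) m) (xs : List (Labelling n)) →
                     count 0 (List.map (Product.map suc t) xs) ≡ 0
count-zero-map-suc t []              = refl
count-zero-map-suc t ((k′ , f) ∷ xs) = count-zero-map-suc t xs

compositionCount : ℕ → ℕ → ℕ
compositionCount n zero    = 0
compositionCount n (suc a) = (n + a) C (a + a)

splitEndCount : ℕ → ℕ → ℕ
splitEndCount n zero          = 0
splitEndCount n (suc zero)    = 0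
splitEndCount n (suc (suc a)) = (n + a) C suc (a + a)

compositionCount-suc : ∀ n k → compositionCount (suc n) k ≡ compositionCount n k + splitEndCount (suc n) k
compositionCount-suc n zero          = refl
compositionCount-suc n (suc zero)    = refl
compositionCount-suc n (suc (suc a)) rewrite +-suc n a | +-suc a a =
  sym (trans (+-comm (suc (n + a) C suc (suc (a + a))) _) (nCk+nC[k+1]≡[n+1]C[k+1] (suc (n + a)) (suc (a + a))))

splitEndCount-suc : ∀ n k → splitEndCount (suc n) (suc k) ≡ splitEndCount n (suc k) + compositionCount n k
splitEndCount-suc n zero    = refl
splitEndCount-suc n (suc a) = trans (sym (nCk+nC[k+1]≡[n+1]C[k+1] (n + a) (a + a)))
                                    (+-comm ((n + a) C (a + a)) _)

count-compositions-suc : ∀ n k →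
  count k (compositions (suc n)) ≡ count k (compositions n) + count k (splitEndCompositions (suc n))
count-compositions-suc n k =
  trans (count-++ (sameEndCompositions (suc n)) (splitEndCompositions (suc n)))
        (cong (_+ count k (splitEndCompositions (suc n))) (count-map id joinLast (compositions n)))

count-splitEnd-suc : ∀ n k →
  count k (splitEndCompositions (suc n)) ≡ count k (splitEndCompositions n) + count k (newBlockCompositions n)
count-splitEnd-suc zero    k = refl
count-splitEnd-suc (suc n) k =
  trans (count-++ (List.map (Product.map₂ joinPenultimate) (splitEndCompositions (suc n))) (newBlockCompositions (suc n)))
        (cong (_+ count k (newBlockCompositions (suc n))) (count-map id joinPenultimate (splitEndCompositions (suc n))))

count-compositions : ∀ n k → count k (compositions n) ≡ compositionCount n k
                             × count k (splitEndCompositions n) ≡ splitEndCount n k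
count-compositions zero    zero          = refl , refl
count-compositions zero    (suc zero)    = refl , refl
count-compositions zero    (suc (suc a)) =
  sym (k>n⇒nCk≡0 (s≤s (m<m+n a (s≤s z≤n)))) , sym (k>n⇒nCk≡0 (s≤s (m≤m+n a a)))
count-compositions (suc n) k             = composition-count , split-count k
  where
  open ≡-Reasoning
  IH = count-compositions n
  split-count : ∀ k → count k (splitEndCompositions (suc n)) ≡ splitEndCount (suc n) k
  split-count zero    = begin
    count 0 (splitEndCompositions (suc n))                                  ≡⟨ count-splitEnd-suc n 0 ⟩
    count 0 (splitEndCompositions n) + count 0 (newBlockCompositions n)     ≡⟨ cong₂ _+_ (proj₂ (IH 0))
                                                                                 (count-zero-map-suc withNewBlock (compositions n)) ⟩
    0                                                                       ∎
  split-count (suc k) = begin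
    count (suc k) (splitEndCompositions (suc n))                            ≡⟨ count-splitEnd-suc n (suc k) ⟩
    count (suc k) (splitEndCompositions n) + count (suc k) (newBlockCompositions n)
                                                                            ≡⟨ cong₂ _+_ (proj₂ (IH (suc k)))
                                                                                 (trans (count-map suc-injective withNewBlock (compositions n)) (proj₁ (IH k))) ⟩
    splitEndCount n (suc k) + compositionCount n k                          ≡⟨ splitEndCount-suc n k ⟨
    splitEndCount (suc n) (suc k)                                           ∎
  composition-count : count k (compositions (suc n)) ≡ compositionCount (suc n) k
  composition-count = begin
    count k (compositions (suc n))                                          ≡⟨ count-compositions-suc n k ⟩
    count k (compositions n) + count k (splitEndCompositions (suc n))       ≡⟨ cong₂ _+_ (proj₁ (IH k)) (split-count k) ⟩
    compositionCount n k + splitEndCount (suc n) k                          ≡⟨ compositionCount-suc n k ⟨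
    compositionCount (suc n) k                                              ∎

length-splitEndCompositions-suc : ∀ n → length (splitEndCompositions (suc n))
                                  ≡ length (splitEndCompositions n) + length (compositions n)
length-splitEndCompositions-suc zero    = refl
length-splitEndCompositions-suc (suc n) = begin
  length (joins ++ newBlockCompositions (suc n))                     ≡⟨ length-++ joins ⟩
  length joins + length (newBlockCompositions (suc n))               ≡⟨ cong₂ _+_
    (length-map (Product.map₂ joinPenultimate) (splitEndCompositions (suc n)))
    (length-map (Product.map suc withNewBlock) (compositions (suc n))) ⟩
  length (splitEndCompositions (suc n)) + length (compositions (suc n)) ∎
  where
  open ≡-Reasoning
  joins = List.map (Product.map₂ joinPenultimate) (splitEndCompositions (suc n))

length-compositions : ∀ n → length (compositions n) ≡ fib (suc (n + n))
                            × length (splitEndCompositions n) ≡ fib (n + n)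
length-compositions zero    = refl , refl
length-compositions (suc n) = composition-count , split-count
  where
  open ≡-Reasoning
  IH = length-compositions n
  split-count : length (splitEndCompositions (suc n)) ≡ fib (suc n + suc n)
  split-count = begin
    length (splitEndCompositions (suc n))                        ≡⟨ length-splitEndCompositions-suc n ⟩
    length (splitEndCompositions n) + length (compositions n)    ≡⟨ cong₂ _+_ (proj₂ IH) (proj₁ IH) ⟩
    fib (n + n) + fib (suc (n + n))                              ≡⟨ +-comm (fib (n + n)) _ ⟩
    fib (suc (suc (n + n)))                                      ≡⟨ cong fib (+-suc (suc n) n) ⟨
    fib (suc n + suc n)                                          ∎
  composition-count : length (compositions (suc n)) ≡ fib (suc (suc n + suc n))
  composition-count = begin
    length (compositions (suc n))                                 ≡⟨ length-++ (sameEndCompositions (suc n)) ⟩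
    length (sameEndCompositions (suc n)) + length (splitEndCompositions (suc n))
      ≡⟨ cong₂ _+_ (trans (length-map (Product.map₂ joinLast) (compositions n)) (proj₁ IH)) split-count ⟩
    fib (suc (n + n)) + fib (suc n + suc n)                       ≡⟨ cong (λ m → fib m + fib (suc n + suc n)) (+-suc n n) ⟨
    fib (n + suc n) + fib (suc n + suc n)                         ≡⟨ +-comm (fib (n + suc n)) _ ⟩
    fib (suc (suc n + suc n))                                     ∎

binomNK-suc : ∀ n a → binomNK (suc n) (suc a) ≡ (n + a) C (a + a)
binomNK-suc n a with suc a ≤? suc n
... | yes (s≤s a≤n) rewrite +-suc n a = begin
  (n + a) C (n ∸ a)               ≡⟨ cong ((n + a) C_) ([m+n]∸[m+o]≡n∸o a n a) ⟨
  (n + a) C ((a + n) ∸ (a + a))   ≡⟨ cong (λ m → (n + a) C (m ∸ (a + a))) (+-comm a n) ⟩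
  (n + a) C ((n + a) ∸ (a + a))   ≡⟨ nCk≡nC[n∸k] (+-monoˡ-≤ a a≤n) ⟨
  (n + a) C (a + a)               ∎
  where open ≡-Reasoning
... | no a≰n = sym (k>n⇒nCk≡0 (+-monoˡ-< a (≰⇒> (a≰n ∘ s≤s))))

∈-compositions⇔ : ∀ n {k} {f : Vec (Fin k) (suc n)} → (k , f) ∈ compositions n ⇔ IsComposition (suc n) k f
∈-compositions⇔ n {f = f} = mk⇔
  (λ f∈ → Equivalence.from isComposition⇔composition (All.lookup (compositions-sound n) f∈))
  (λ comp → compositions-complete n f (Equivalence.to isComposition⇔composition comp))

theorem13 : (n : ℕ) → 1 ≤ n →
    ((k : ℕ) → 1 ≤ k → HasCount (IsComposition n k) (binomNK n k))
    × HasCount {Σ ℕ (λ k → Vec (Fin k) n)} (λ p → IsComposition n (proj₁ p) (proj₂ p)) (fib (2 * n ∸ 1))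
theorem13 (suc n) _ = with-k-blocks , all-compositions
  where
  with-k-blocks : (k : ℕ) → 1 ≤ k → HasCount (IsComposition (suc n) k) (binomNK (suc n) k)
  with-k-blocks (suc a) _ =
    withBlockCount (suc a) (compositions n) ,
    withBlockCount-unique (compositions-unique n) ,
    (λ f → mk⇔ (Equivalence.to (∈-compositions⇔ n) ∘ ∈-withBlockCount⁻)
               (∈-withBlockCount⁺ ∘ Equivalence.from (∈-compositions⇔ n))) ,
    trans (proj₁ (count-compositions n (suc a))) (sym (binomNK-suc n a))
  all-compositions : HasCount {Σ ℕ (λ k → Vec (Fin k) (suc n))} (λ p → IsComposition (suc n) (proj₁ p) (proj₂ p))
                              (fib (2 * suc n ∸ 1))
  all-compositions =
    compositions n ,
    compositions-unique n ,
    (λ _ → ∈-compositions⇔ n) ,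
    trans (proj₁ (length-compositions n))
          (cong fib (sym (trans (+-suc n (n + 0)) (cong (λ m → suc (n + m)) (+-identityʳ n)))))
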